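{- Let $n\ge 3$ and $k\ge 0$ be integers, let $S_n^k$ be the crown and let $G_n^k$ be its graph of critical pairs. Then the chromatic number of $G_n^k$ equals the dimension of $S_n^k$.
   Context: The crown $S_n^k$ is the height-2 poset on $A\cup B$, where $A=\{a_1,\dots,a_{n+k}\}$ is the set of minimal elements and $B=\{b_1,\dots,b_{n+k}\}$ the set of maximal elements (elements of $A$ are pairwise incomparable, as are elements of $B$); indices are taken cyclically modulo $n+k$. For each $i$, $a_i$ is incomparable to $b_j$ when $j\in\{i,i+1,\dots,i+k\}$ (mod $n+k$), and $a_i<b_j$ otherwise. Let $\mathrm{Inc}(A,B)$ be the set of pairs $(a,b)\in A\times B$ with $a$ incomparable to $b$ (these are exactly the critical pairs of $S_n^k$). The graph of critical pairs $G_n^k$ has vertex set $\mathrm{Inc}(A,B)$, with $(a,b)$ and $(x,y)$ adjacent iff $a<y$ and $x<b$ in $S_n^k$. The dimension of a poset $P$ is the least $d$ such that there are $d$ linear extensions of $P$ whose intersection is $P$. -}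

module Defs where

open import Data.Nat using (ℕ; _+_; _≤_; _<_)
open import Data.Fin using (Fin; toℕ)
open import Data.Sum using (_⊎_; inj₁; inj₂)
open import Data.Product using (Σ; _×_; ∃-syntax; _,_; proj₁; proj₂)
open import Relation.Nullary using (¬_)
open import Relation.Binary.PropositionalEquality using (_≡_; _≢_)
open import Relation.Binary.Structures using (IsTotalOrder)

-- Generic finite-poset notions (a poset given by a carrier and a
-- reflexive/antisymmetric/transitive relation _≤_; we only need the
-- relation itself for the notions below).

module _ {X : Set} (_≤P_ : X → X → Set) where

  _<P_ : X → X → Set
  x <P y = (x ≤P y) × (x ≢ y)

  Incomparable : X → X → Set
  Incomparable x y = ¬ (x ≤P y) × ¬ (y ≤P x)

  record LinearExtension : Set₁ where
    field
      _≤L_    : X → X → Set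
      isTotal : IsTotalOrder _≡_ _≤L_
      extends : ∀ {x y} → x ≤P y → x ≤L y

  open LinearExtension public

  Realizer : ℕ → Set₁
  Realizer d = Σ (Fin d → LinearExtension) λ L →
    ∀ x y → (∀ i → _≤L_ (L i) x y) → x ≤P y

  IsDimension : ℕ → Set₁
  IsDimension d = Realizer d × (∀ d′ → d′ < d → ¬ Realizer d′)

module _ {V : Set} (E : V → V → Set) where

  ProperColoring : ℕ → Set
  ProperColoring c = Σ (V → Fin c) λ f → ∀ u v → E u v → f u ≢ f v

  IsChromaticNumber : ℕ → Set
  IsChromaticNumber c = ProperColoring c × (∀ c′ → c′ < c → ¬ ProperColoring c′)

-- The crown S_n^k on A ∪ B, A = {a_0..a_{m-1}}, B = {b_0..b_{m-1}},
-- m = n + k (0-based indices; inj₁ i = a_i, inj₂ j = b_j).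

-- j ∈ {i, i+1, ..., i+k} (mod m), for i j < m.
CycWindow : (m k : ℕ) → Fin m → Fin m → Set
CycWindow m k i j =
  (toℕ i ≤ toℕ j × toℕ j ≤ toℕ i + k) ⊎
  (toℕ j < toℕ i × toℕ j + m ≤ toℕ i + k)

CrownElem : ℕ → ℕ → Set
CrownElem n k = Fin (n + k) ⊎ Fin (n + k)

data CrownLe (n k : ℕ) : CrownElem n k → CrownElem n k → Set where
  le-refl : ∀ {x} → CrownLe n k x x
  le-ab   : ∀ {i j} → ¬ CycWindow (n + k) k i j → CrownLe n k (inj₁ i) (inj₂ j)

CrownCritical : ℕ → ℕ → Set
CrownCritical n k =
  Σ (Fin (n + k) × Fin (n + k)) λ p →
    Incomparable (CrownLe n k) (inj₁ (proj₁ p)) (inj₂ (proj₂ p))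

CrownCPAdj : (n k : ℕ) → CrownCritical n k → CrownCritical n k → Set
CrownCPAdj n k ((i , j) , _) ((i′ , j′) , _) =
  _<P_ (CrownLe n k) (inj₁ i) (inj₂ j′) × _<P_ (CrownLe n k) (inj₁ i′) (inj₂ j)

module Submission where

open import Defs
open import Data.Nat using (ℕ; _≤_)
open import Data.Product using (∃-syntax; _×_)
open import Data.Nat
open import Data.Nat.Properties
open import Data.Nat.DivMod
  using (_%_; _/_; _mod_; m%n<n; m%n%n≡m%n; m≡m%n+[m/n]*n; m<n*o⇒m/o<n; %-distribˡ-+;
         [m+n]%n≡m%n; [m+kn]%n≡m%n; m<n⇒m%n≡m; m≤n⇒[n∸m]%m≡n%m)
open import Data.Nat.Tactic.RingSolver using (solve-∀)
open import Data.Fin using (Fin; zero; suc; toℕ; fromℕ<; combine) renaming (_≟_ to _≟ᶠ_)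
open import Data.Fin.Properties using (toℕ-injective; toℕ-fromℕ<; toℕ<n; combine-injective; injective⇒≤)
open import Data.Product using (_,_; proj₁; proj₂)
open import Data.Sum using (_⊎_; inj₁; inj₂; reduce; [_,_]′)
open import Data.Empty using (⊥; ⊥-elim)
open import Function using (_∘_; id; flip)
open import Function.Definitions using (Injective)
open import Level using (0ℓ)
open import Relation.Nullary using (¬_; Dec; yes; no; contradiction)
open import Relation.Nullary.Decidable using (_×-dec_; _⊎-dec_)
open import Relation.Unary using (Pred; Decidable)
open import Relation.Binary.Bundles using (Setoid)
open import Relation.Binary.Structures using (IsTotalOrder)
open import Relation.Binary.PropositionalEquality
import Relation.Binary.Reasoning.Setoid as SetoidReasoning

-- Both numbers equal D = ⌈2m/(k+2)⌉, where m = n + k.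
--
-- A realizer colours the graph of critical pairs: give (a, b) the index of an extension putting
-- b below a; two adjacent pairs are never reversed by the same extension. Hence χ ≤ dim.
--
-- The 2m critical pairs (a_⌊s/2⌋, b_⌊(s+k)/2⌋) span a circular graph in which pairs at cyclic
-- distance at least k+2 are adjacent; a colour class of it has at most k+2 members, so χ ≥ D.
--
-- Conversely D extensions suffice. Extension r rotates the crown by c_r, stacks the a's in levels
-- rising on the first h_r positions of the window [0, k] and falling on the rest, and puts each
-- b just above every a below it. With h₀ = ⌊k/2⌋, c_{r+1} = c_r + h_r + 1 and h_{r+1} = k − h_r,
-- the rotated positions at which a critical pair (a_x, b_{x+t}) is reversed in consecutive
-- extensions abut and advance by k+2 every two steps, so D of them cover a full turn.

max : ∀ {N} → (Fin N → ℕ) → ℕ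
max {zero}  f = 0
max {suc N} f = f zero ⊔ max (f ∘ suc)

≤-max : ∀ {N} (f : Fin N → ℕ) i → f i ≤ max f
≤-max f zero    = m≤m⊔n _ _
≤-max f (suc i) = ≤-trans (≤-max (f ∘ suc) i) (m≤n⊔m _ _)

max-< : ∀ {N} (f : Fin N → ℕ) {b} → 0 < b → (∀ i → f i < b) → max f < b
max-< {zero}  f 0<b f<b = 0<b
max-< {suc N} f 0<b f<b = ⊔-lub (f<b zero) (max-< (f ∘ suc) 0<b (f<b ∘ suc))

least : ∀ {N ℓ} {P : Pred (Fin N) ℓ} → Decidable P → ∀ {s} → P s →
        ∃[ s₀ ] P s₀ × (∀ s → P s → toℕ s₀ ≤ toℕ s)
least {suc N} P? {s} Ps with P? zero
... | yes P0 = zero , P0 , λ _ _ → z≤n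
... | no ¬P0 with s
...   | zero  = contradiction Ps ¬P0
...   | suc s with least (P? ∘ suc) Ps
...     | s₀ , Ps₀ , minimal = suc s₀ , Ps₀ , λ { zero P0 → contradiction P0 ¬P0 ; (suc s) Pss → s≤s (minimal s Pss) }

m+n*[1+o]≡n+m+n*o : ∀ m n o → m + n * suc o ≡ n + m + n * o
m+n*[1+o]≡n+m+n*o = solve-∀

⌊t+t+n/2⌋≡t+⌊n/2⌋ : ∀ t n → ⌊ t + t + n /2⌋ ≡ t + ⌊ n /2⌋
⌊t+t+n/2⌋≡t+⌊n/2⌋ zero    n = refl
⌊t+t+n/2⌋≡t+⌊n/2⌋ (suc t) n rewrite +-suc t t = cong suc (⌊t+t+n/2⌋≡t+⌊n/2⌋ t n)

⌊/2⌋-shift : ∀ t {a b} → t + t + a ≤ b → t + ⌊ a /2⌋ ≤ ⌊ b /2⌋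
⌊/2⌋-shift t {a} le = subst (_≤ _) (⌊t+t+n/2⌋≡t+⌊n/2⌋ t a) (⌊n/2⌋-mono le)

*+-injective : ∀ {m a b i j} → i < m → j < m → a * m + i ≡ b * m + j → a ≡ b × i ≡ j
*+-injective {m} {a} {b} {i} {j} i<m j<m eq = a≡b , i≡j
  where
    instance _ = >-nonZero (≤-trans (s≤s z≤n) i<m)
    i≡j : i ≡ j
    i≡j = begin
      i               ≡⟨ m<n⇒m%n≡m i<m ⟨
      i % m           ≡⟨ [m+kn]%n≡m%n i a m ⟨
      (i + a * m) % m ≡⟨ cong (_% m) (trans (+-comm i _) (trans eq (+-comm _ j))) ⟩
      (j + b * m) % m ≡⟨ [m+kn]%n≡m%n j b m ⟩
      j % m           ≡⟨ m<n⇒m%n≡m j<m ⟩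
      j               ∎
      where open ≡-Reasoning
    a≡b : a ≡ b
    a≡b = *-cancelʳ-≡ a b m (+-cancelʳ-≡ i _ _ (trans eq (cong (b * m +_) (sym i≡j))))

*+-mono-< : ∀ {m a b i} j → a < b → i < m → a * m + i < b * m + j
*+-mono-< {m} {a} {b} {i} j a<b i<m = begin-strict
  a * m + i ≡⟨ +-comm (a * m) i ⟩
  i + a * m <⟨ +-monoˡ-< (a * m) i<m ⟩
  suc a * m ≤⟨ *-monoˡ-≤ m a<b ⟩
  b * m     ≤⟨ m≤m+n (b * m) j ⟩
  b * m + j ∎
  where open ≤-Reasoning

module _ {X : Set} {_≤P_ : X → X → Set} where

  extensionByKey : (key : X → ℕ) → Injective _≡_ _≡_ key →
                   (∀ {x y} → x ≤P y → key x ≤ key y) → LinearExtension _≤P_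
  extensionByKey key key-injective key-mono = record
    { _≤L_    = λ x y → key x ≤ key y
    ; isTotal = record
      { isPartialOrder = record
        { isPreorder = record
          { isEquivalence = isEquivalence
          ; reflexive     = λ { refl → ≤-refl }
          ; trans         = ≤-trans
          }
        ; antisym = λ x≤y y≤x → key-injective (≤-antisym x≤y y≤x)
        }
      ; total = λ x y → ≤-total (key x) (key y)
      }
    ; extends = key-mono
    }

escape : ∀ {k m d} → suc k < m → 0 < d → d < m → ∃[ s ] s ≤ k × k < d + s × d + s < m
escape {k} {m} {d} k<m 0<d d<m with k <? d
... | yes k<d = 0 , z≤n , subst (k <_) (sym (+-identityʳ d)) k<d , subst (_< m) (sym (+-identityʳ d)) d<m
... | no  k≮d = suc k ∸ d , m≤n+o⇒m∸n≤o (suc k) d (+-monoˡ-≤ k 0<d) ,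
                subst (k <_) (sym d+s≡) ≤-refl , subst (_< m) (sym d+s≡) k<m
  where d+s≡ = m+[n∸m]≡n (m≤n⇒m≤1+n (≮⇒≥ k≮d))

bracket : ∀ (f : ℕ → ℕ) {X} D → f 0 ≤ X → X < f D → ∃[ r ] r < D × f r ≤ X × X < f (suc r)
bracket f zero    f0≤X X<f0 = contradiction f0≤X (<⇒≱ X<f0)
bracket f (suc D) f0≤X X<fD with f D ≤? _
... | yes fD≤X = D , ≤-refl , fD≤X , X<fD
... | no  fD≰X with bracket f D f0≤X (≰⇒> fD≰X)
...   | r , r<D , fr≤X , X<fr+1 = r , m<n⇒m<1+n r<D , fr≤X , X<fr+1

+-half : ∀ {a b} → a + a ≤ suc (b + b) → a ≤ b
+-half {zero}          _  = z≤n
+-half {suc a} {zero}  (s≤s a+1+a≤0) = contradiction (n≤0⇒n≡0 a+1+a≤0) (m+1+n≢0 a)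
+-half {suc a} {suc b} (s≤s le) rewrite +-suc a a | +-suc b b = s≤s (+-half (s≤s⁻¹ le))

n≤1+⌊n/2⌋+⌊n/2⌋ : ∀ n → n ≤ suc (⌊ n /2⌋ + ⌊ n /2⌋)
n≤1+⌊n/2⌋+⌊n/2⌋ zero          = z≤n
n≤1+⌊n/2⌋+⌊n/2⌋ (suc zero)    = s≤s z≤n
n≤1+⌊n/2⌋+⌊n/2⌋ (suc (suc n)) rewrite +-suc ⌊ n /2⌋ ⌊ n /2⌋ = s≤s (s≤s (n≤1+⌊n/2⌋+⌊n/2⌋ n))

odd<even : ∀ {a b} → a < b → suc (2 * a) < 2 * b
odd<even {a} {b} a<b = subst (_≤ 2 * b) (*-suc 2 a) (*-monoʳ-≤ 2 a<b)

even<odd : ∀ {a b} → b ≤ a → 2 * b < suc (2 * a)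
even<odd b≤a = s≤s (*-monoʳ-≤ 2 b≤a)

module _ {p c Q : ℕ} .{{_ : NonZero Q}} (Q+Q≤p : Q + Q ≤ p) (g : Fin p → Fin c)
         (apart : ∀ s s′ → toℕ s + Q ≤ toℕ s′ → toℕ s′ + Q ≤ toℕ s + p → g s ≢ g s′) where

  private
    leader : Fin p → Fin p
    leader s = proj₁ (least (λ s′ → g s′ ≟ᶠ g s) {s} refl)

    leader-colour : ∀ s → g (leader s) ≡ g s
    leader-colour s = proj₁ (proj₂ (least (λ s′ → g s′ ≟ᶠ g s) {s} refl))

    leader-≤ : ∀ {s s′} → g s′ ≡ g s → toℕ (leader s) ≤ toℕ s′
    leader-≤ {s} {s′} = proj₂ (proj₂ (least (λ s′ → g s′ ≟ᶠ g s) {s} refl)) s′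

    leader-cong : ∀ {s s′} → g s ≡ g s′ → leader s ≡ leader s′
    leader-cong {s} {s′} eq = toℕ-injective (≤-antisym
      (leader-≤ (trans (leader-colour s′) (sym eq)))
      (leader-≤ (trans (leader-colour s) eq)))

    dist : Fin p → ℕ
    dist s = toℕ s ∸ toℕ (leader s)

    leader+dist : ∀ s → toℕ (leader s) + dist s ≡ toℕ s
    leader+dist s = m+[n∸m]≡n (leader-≤ refl)

    Q≤p : Q ≤ p
    Q≤p = ≤-trans (m≤m+n Q Q) Q+Q≤p

    wraps : ∀ s → Q ≤ dist s → p < dist s + Q
    wraps s Q≤d with p <? dist s + Q
    ... | yes p<d+Q = p<d+Q
    ... | no  p≮d+Q = contradiction (leader-colour s) (apart (leader s) s
      (subst (r + Q ≤_) (leader+dist s) (+-monoʳ-≤ r Q≤d))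
      (subst (_≤ r + p) (trans (sym (+-assoc r (dist s) Q)) (cong (_+ Q) (leader+dist s)))
                    (+-monoʳ-≤ r (≮⇒≥ p≮d+Q))))
      where r = toℕ (leader s)

    fold : ℕ → ℕ
    fold d with Q ≤? d
    ... | yes _ = d ∸ (p ∸ Q)
    ... | no  _ = d

    fold-near : ∀ {d} → d < Q → fold d ≡ d
    fold-near {d} d<Q with Q ≤? d
    ... | yes Q≤d = contradiction Q≤d (<⇒≱ d<Q)
    ... | no  _   = refl

    fold-far : ∀ {d} → Q ≤ d → d ≤ p → p < d + Q → fold d + (p ∸ Q) ≡ d
    fold-far {d} Q≤d d≤p p<d+Q with Q ≤? d
    ... | no  Q≰d = contradiction Q≤d Q≰d
    ... | yes _   = m∸n+n≡m (m≤n+o⇒m∸n≤o p Q (<⇒≤ (subst (p <_) (+-comm d Q) p<d+Q)))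

    dist<p : ∀ s → dist s < p
    dist<p s = ≤-<-trans (m∸n≤m (toℕ s) (toℕ (leader s))) (toℕ<n s)

    fold-dist-far : ∀ s → Q ≤ dist s → fold (dist s) + (p ∸ Q) ≡ dist s
    fold-dist-far s Q≤d = fold-far Q≤d (<⇒≤ (dist<p s)) (wraps s Q≤d)

    fold<Q : ∀ s → fold (dist s) < Q
    fold<Q s with Q ≤? dist s
    ... | no  Q≰d = ≰⇒> Q≰d
    ... | yes _   = m<n+o⇒m∸n<o (dist s) (p ∸ Q) (subst (dist s <_) (sym (m∸n+n≡m Q≤p)) (dist<p s))

    -- Two members folded onto the same slot, one near and one far from the leader, lie exactly
    -- p ∸ Q ≥ Q apart, hence are adjacent.
    near-far : ∀ {s s′} → g s ≡ g s′ → dist s < Q → Q ≤ dist s′ → fold (dist s) ≡ fold (dist s′) → ⊥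
    near-far {s} {s′} eq d<Q Q≤d′ same = apart s s′ s+Q≤s′ s′+Q≤s+p eq
      where
        r = toℕ (leader s)
        s≡ : toℕ s ≡ r + dist s
        s≡ = sym (leader+dist s)
        s′≡ : toℕ s′ ≡ r + (dist s + (p ∸ Q))
        s′≡ = begin
          toℕ s′                                   ≡⟨ leader+dist s′ ⟨
          toℕ (leader s′) + dist s′                ≡⟨ cong (λ l → toℕ l + dist s′) (leader-cong eq) ⟨
          r + dist s′                              ≡⟨ cong (r +_) (fold-dist-far s′ Q≤d′) ⟨
          r + (fold (dist s′) + (p ∸ Q))           ≡⟨ cong (λ f → r + (f + (p ∸ Q))) (trans (sym same) (fold-near d<Q)) ⟩
          r + (dist s + (p ∸ Q))                   ∎
          where open ≡-Reasoning
        Q≤p∸Q : Q ≤ p ∸ Q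
        Q≤p∸Q = m+n≤o⇒m≤o∸n Q Q+Q≤p
        s+Q≤s′ : toℕ s + Q ≤ toℕ s′
        s+Q≤s′ = begin
          toℕ s + Q                ≡⟨ cong (_+ Q) s≡ ⟩
          r + dist s + Q           ≡⟨ +-assoc r (dist s) Q ⟩
          r + (dist s + Q)         ≤⟨ +-monoʳ-≤ r (+-monoʳ-≤ (dist s) Q≤p∸Q) ⟩
          r + (dist s + (p ∸ Q))   ≡⟨ s′≡ ⟨
          toℕ s′                   ∎
          where open ≤-Reasoning
        s′+Q≤s+p : toℕ s′ + Q ≤ toℕ s + p
        s′+Q≤s+p = ≤-reflexive (begin
          toℕ s′ + Q                    ≡⟨ cong (_+ Q) s′≡ ⟩
          r + (dist s + (p ∸ Q)) + Q    ≡⟨ regroup r (dist s) (p ∸ Q) Q ⟩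
          r + dist s + (p ∸ Q + Q)      ≡⟨ cong₂ _+_ (sym s≡) (m∸n+n≡m Q≤p) ⟩
          toℕ s + p                     ∎)
          where
            open ≡-Reasoning
            regroup : ∀ r d a Q → r + (d + a) + Q ≡ r + d + (a + Q)
            regroup = solve-∀

    dist-injective : ∀ {s s′} → g s ≡ g s′ → fold (dist s) ≡ fold (dist s′) → dist s ≡ dist s′
    dist-injective {s} {s′} eq same with dist s <? Q | dist s′ <? Q
    ... | yes d<Q | yes d′<Q = trans (sym (fold-near d<Q)) (trans same (fold-near d′<Q))
    ... | yes d<Q | no  d′≮Q = ⊥-elim (near-far eq d<Q (≮⇒≥ d′≮Q) same)
    ... | no  d≮Q | yes d′<Q = ⊥-elim (near-far (sym eq) d′<Q (≮⇒≥ d≮Q) (sym same))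
    ... | no  d≮Q | no  d′≮Q = trans (sym (fold-dist-far s (≮⇒≥ d≮Q)))
                                 (trans (cong (_+ (p ∸ Q)) same) (fold-dist-far s′ (≮⇒≥ d′≮Q)))

    code : Fin p → Fin (c * Q)
    code s = combine (g s) (fromℕ< (fold<Q s))

    code-injective : ∀ {s s′} → code s ≡ code s′ → s ≡ s′
    code-injective {s} {s′} eq with combine-injective (g s) _ (g s′) _ eq
    ... | same-colour , same-slot = toℕ-injective (begin
      toℕ s                        ≡⟨ leader+dist s ⟨
      toℕ (leader s) + dist s      ≡⟨ cong₂ (λ l d → toℕ l + d) (leader-cong same-colour) (dist-injective same-colour same-fold) ⟩
      toℕ (leader s′) + dist s′    ≡⟨ leader+dist s′ ⟩
      toℕ s′                       ∎)
      where
        open ≡-Reasoning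
        same-fold : fold (dist s) ≡ fold (dist s′)
        same-fold = trans (sym (toℕ-fromℕ< (fold<Q s))) (trans (cong toℕ same-slot) (toℕ-fromℕ< (fold<Q s′)))

  circularColouring⇒p≤c*Q : p ≤ c * Q
  circularColouring⇒p≤c*Q = injective⇒≤ code-injective

module _ {X : Set} {_≤P_ : X → X → Set} (L : LinearExtension _≤P_) where
  open IsTotalOrder (isTotal L) public
    using () renaming (trans to ≤L-trans; antisym to ≤L-antisym; total to ≤L-total)

module _ {X : Set} {_≤P_ : X → X → Set} where

  firstReversal : ∀ {d} (L : Fin d → LinearExtension _≤P_) x y →
                  (∀ ℓ → _≤L_ (L ℓ) x y) ⊎ ∃[ ℓ ] _≤L_ (L ℓ) y x
  firstReversal {zero}  L x y = inj₁ λ ()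
  firstReversal {suc d} L x y with ≤L-total (L zero) x y
  ... | inj₂ y≤x = inj₂ (zero , y≤x)
  ... | inj₁ x≤y with firstReversal (L ∘ suc) x y
  ...   | inj₁ all-x≤y   = inj₁ λ { zero → x≤y ; (suc ℓ) → all-x≤y ℓ }
  ...   | inj₂ (ℓ , y≤x) = inj₂ (suc ℓ , y≤x)

module _ {n k : ℕ} where

  realizer⇒colouring : ∀ {d} → Realizer (CrownLe n k) d → ProperColoring (CrownCPAdj n k) d
  realizer⇒colouring {d} (L , realizes) = colour , proper
    where
      reverser : (v : CrownCritical n k) →
                 ∃[ ℓ ] _≤L_ (L ℓ) (inj₂ (proj₂ (proj₁ v))) (inj₁ (proj₁ (proj₁ v)))
      reverser ((i , j) , a∦b , _) with firstReversal L (inj₁ i) (inj₂ j)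
      ... | inj₁ all-a≤b = contradiction (realizes (inj₁ i) (inj₂ j) all-a≤b) a∦b
      ... | inj₂ r       = r

      colour : CrownCritical n k → Fin d
      colour = proj₁ ∘ reverser

      -- In a common extension b ≤ a ≤ b′ ≤ a′ ≤ b, which forces a′ = b.
      proper : ∀ u v → CrownCPAdj n k u v → colour u ≢ colour v
      proper u v ((a≤b′ , _) , (a′≤b , _)) same with reverser u | reverser v
      ... | ℓ , b≤a | ℓ′ , b′≤a′ with refl ← same
        with () ← ≤L-antisym (L ℓ) (extends (L ℓ) a′≤b)
                    (≤L-trans (L ℓ) b≤a (≤L-trans (L ℓ) (extends (L ℓ) a≤b′) b′≤a′))

module Crown (n′ k : ℕ) where

  n m′ m : ℕ
  n  = 3 + n′
  m′ = 2 + n′ + k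
  m  = suc m′

  k<m′ : k < m′
  k<m′ = s≤s (m≤n+m k (suc n′))

  k<m : k < m
  k<m = m<n⇒m<1+n k<m′

  CW : Fin m → Fin m → Set
  CW = CycWindow m k

  infix 4 _≡ₘ_
  record _≡ₘ_ (a b : ℕ) : Set where
    constructor by%
    field %≡% : a % m ≡ b % m

  ≡ₘ-setoid : Setoid 0ℓ 0ℓ
  ≡ₘ-setoid = record
    { Carrier       = ℕ
    ; _≈_           = _≡ₘ_
    ; isEquivalence = record
      { refl  = by% refl
      ; sym   = λ (by% e) → by% (sym e)
      ; trans = λ (by% e) (by% f) → by% (trans e f)
      }
    }

  module ≡ₘ-Reasoning = SetoidReasoning ≡ₘ-setoid

  ≡ₘ-+ʳ : ∀ {a b} c → a ≡ₘ b → a + c ≡ₘ b + c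
  ≡ₘ-+ʳ {a} {b} c (by% a≡b) = by% (begin
    (a + c) % m                ≡⟨ %-distribˡ-+ a c m ⟩
    (a % m + c % m) % m        ≡⟨ cong (λ r → (r + c % m) % m) a≡b ⟩
    (b % m + c % m) % m        ≡⟨ %-distribˡ-+ b c m ⟨
    (b + c) % m                ∎)
    where open ≡-Reasoning

  ≡ₘ-+ˡ : ∀ c {a b} → a ≡ₘ b → c + a ≡ₘ c + b
  ≡ₘ-+ˡ c {a} {b} a≡b = subst₂ _≡ₘ_ (+-comm a c) (+-comm b c) (≡ₘ-+ʳ c a≡b)

  +*m≡ₘ : ∀ a c → a + c * m ≡ₘ a
  +*m≡ₘ a c = by% ([m+kn]%n≡m%n a c m)

  +m≡ₘ : ∀ a → a + m ≡ₘ a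
  +m≡ₘ a = by% ([m+n]%n≡m%n a m)

  ≡ₘ-cancelˡ : ∀ c {a b} → c + a ≡ₘ c + b → a ≡ₘ b
  ≡ₘ-cancelˡ c {a} {b} c+a≡c+b = begin
    a                  ≈⟨ +*m≡ₘ a c ⟨
    a + c * m          ≡⟨ m+n*[1+o]≡n+m+n*o a c m′ ⟩
    c + a + c * m′     ≈⟨ ≡ₘ-+ʳ (c * m′) c+a≡c+b ⟩
    c + b + c * m′     ≡⟨ m+n*[1+o]≡n+m+n*o b c m′ ⟨
    b + c * m          ≈⟨ +*m≡ₘ b c ⟩
    b                  ∎
    where open ≡ₘ-Reasoning

  ≡ₘ⇒≡ : ∀ {a b} → a < m → b < m → a ≡ₘ b → a ≡ b
  ≡ₘ⇒≡ a<m b<m (by% a≡b) = trans (sym (m<n⇒m%n≡m a<m)) (trans a≡b (m<n⇒m%n≡m b<m))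

  open Setoid ≡ₘ-setoid using () renaming (sym to ≡ₘ-sym; trans to ≡ₘ-trans)

  %≡ₘ : ∀ a → a % m ≡ₘ a
  %≡ₘ a = by% (m%n%n≡m%n a m)

  -- offset and height are used only through their characterising lemmas; they are opaque
  -- because unfolding them in goals makes unification and with-abstraction blow up.
  opaque
    offset : ℕ → Fin m → ℕ
    offset c z = (toℕ z + c * m′) % m

    offset<m : ∀ c z → offset c z < m
    offset<m c z = m%n<n (toℕ z + c * m′) m

    +offset≡ₘ : ∀ c z → c + offset c z ≡ₘ toℕ z
    +offset≡ₘ c z = begin
      c + offset c z           ≈⟨ ≡ₘ-+ˡ c (%≡ₘ (toℕ z + c * m′)) ⟩
      c + (toℕ z + c * m′)     ≡⟨ trans (m+n*[1+o]≡n+m+n*o (toℕ z) c m′) (+-assoc c (toℕ z) _) ⟨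
      toℕ z + c * m            ≈⟨ +*m≡ₘ (toℕ z) c ⟩
      toℕ z                    ∎
      where open ≡ₘ-Reasoning

  offset-unique : ∀ {c z u} → u < m → c + u ≡ₘ toℕ z → offset c z ≡ u
  offset-unique {c} {z} u<m c+u≡z =
    ≡ₘ⇒≡ (offset<m c z) u<m (≡ₘ-cancelˡ c (≡ₘ-trans (+offset≡ₘ c z) (≡ₘ-sym c+u≡z)))

  offset-pos : ∀ {l i} → l ≢ i → 0 < offset (toℕ l) i
  offset-pos {l} {i} l≢i = n≢0⇒n>0 λ offset≡0 → l≢i (toℕ-injective (≡ₘ⇒≡ (toℕ<n l) (toℕ<n i)
    (subst (_≡ₘ toℕ i) (trans (cong (toℕ l +_) offset≡0) (+-identityʳ (toℕ l))) (+offset≡ₘ (toℕ l) i))))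

  window⇒offset≤k : ∀ {i j} → CW i j → offset (toℕ i) j ≤ k
  window⇒offset≤k {i} {j} (inj₁ (i≤j , j≤i+k)) =
    subst (_≤ k) (sym (offset-unique {toℕ i} {j} (≤-<-trans (m∸n≤m (toℕ j) (toℕ i)) (toℕ<n j))
                                     (by% (cong (_% m) (m+[n∸m]≡n i≤j)))))
          (m≤n+o⇒m∸n≤o (toℕ j) (toℕ i) j≤i+k)
  window⇒offset≤k {i} {j} (inj₂ (j<i , j+m≤i+k)) =
    subst (_≤ k) (sym (offset-unique (m<n+o⇒m∸n<o (toℕ j + m) (toℕ i) (+-monoˡ-< m j<i)) wraps))
          (m≤n+o⇒m∸n≤o (toℕ j + m) (toℕ i) j+m≤i+k)
    where
      open ≡ₘ-Reasoning
      wraps : toℕ i + (toℕ j + m ∸ toℕ i) ≡ₘ toℕ j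
      wraps = begin
        toℕ i + (toℕ j + m ∸ toℕ i)  ≡⟨ m+[n∸m]≡n (≤-trans (<⇒≤ (toℕ<n i)) (m≤n+m m (toℕ j))) ⟩
        toℕ j + m                    ≈⟨ +m≡ₘ (toℕ j) ⟩
        toℕ j                        ∎

  offset≤k⇒window : ∀ {i j} → offset (toℕ i) j ≤ k → CW i j
  offset≤k⇒window {i} {j} u≤k with toℕ i + offset (toℕ i) j <? m
  ... | yes i+u<m = inj₁ (subst (toℕ i ≤_) i+u≡j (m≤m+n (toℕ i) _) ,
                          subst (_≤ toℕ i + k) i+u≡j (+-monoʳ-≤ (toℕ i) u≤k))
    where i+u≡j = ≡ₘ⇒≡ i+u<m (toℕ<n j) (+offset≡ₘ (toℕ i) j)
  ... | no  i+u≮m = inj₂ (subst (_< toℕ i) i+u∸m≡j i+u∸m<i ,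
                          subst (λ j → j + m ≤ toℕ i + k) i+u∸m≡j
                                (subst (_≤ toℕ i + k) (sym (m∸n+n≡m m≤i+u)) (+-monoʳ-≤ (toℕ i) u≤k)))
    where
      u = offset (toℕ i) j
      m≤i+u = ≮⇒≥ i+u≮m
      i+u∸m≡j : toℕ i + u ∸ m ≡ toℕ j
      i+u∸m≡j = ≡ₘ⇒≡ (m<n+o⇒m∸n<o (toℕ i + u) m (+-mono-< (toℕ<n i) (offset<m (toℕ i) j))) (toℕ<n j)
                     (≡ₘ-trans (by% (m≤n⇒[n∸m]%m≡n%m m≤i+u)) (+offset≡ₘ (toℕ i) j))
      i+u∸m<i : toℕ i + u ∸ m < toℕ i
      i+u∸m<i = subst (toℕ i + u ∸ m <_) (m+n∸n≡m (toℕ i) m)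
                      (∸-monoˡ-< (+-monoʳ-< (toℕ i) (offset<m (toℕ i) j)) m≤i+u)

  window-by : ∀ {i j t} → t ≤ k → toℕ i + t ≡ₘ toℕ j → CW i j
  window-by t≤k i+t≡j = offset≤k⇒window (subst (_≤ k) (sym (offset-unique (≤-<-trans t≤k k<m) i+t≡j)) t≤k)

  ¬window-by : ∀ {i j e} → k < e → e < m → toℕ i + e ≡ₘ toℕ j → ¬ CW i j
  ¬window-by k<e e<m i+e≡j ij = <⇒≱ k<e (subst (_≤ k) (offset-unique e<m i+e≡j) (window⇒offset≤k ij))

  window? : ∀ i j → Dec (CW i j)
  window? i j = ((toℕ i ≤? toℕ j) ×-dec (toℕ j ≤? toℕ i + k)) ⊎-dec
                ((toℕ j <? toℕ i) ×-dec (toℕ j + m ≤? toℕ i + k))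

  point : ℕ → Fin m
  point a = a mod m

  point≡ₘ : ∀ a → toℕ (point a) ≡ₘ a
  point≡ₘ a = by% (trans (cong (_% m) (toℕ-fromℕ< (m%n<n a m))) (m%n%n≡m%n a m))

  window⇒incomparable : ∀ {i j} → CW i j → Incomparable (CrownLe n k) (inj₁ i) (inj₂ j)
  window⇒incomparable ij = (λ { (le-ab ¬ij) → ¬ij ij }) , λ ()

  ¬window⇒< : ∀ {i j} → ¬ CW i j → _<P_ (CrownLe n k) (inj₁ i) (inj₂ j)
  ¬window⇒< ¬ij = le-ab ¬ij , λ ()

  point-window : ∀ {a b} → a ≤ b → b ≤ k + a → CW (point a) (point b)
  point-window {a} {b} a≤b b≤k+a =
    window-by (m≤n+o⇒m∸n≤o b a (subst (b ≤_) (+-comm k a) b≤k+a)) (begin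
      toℕ (point a) + (b ∸ a)   ≈⟨ ≡ₘ-+ʳ (b ∸ a) (point≡ₘ a) ⟩
      a + (b ∸ a)               ≡⟨ m+[n∸m]≡n a≤b ⟩
      b                         ≈⟨ point≡ₘ b ⟨
      toℕ (point b)             ∎)
    where open ≡ₘ-Reasoning

  point-¬window : ∀ {a b} → suc k + a ≤ b → b < m + a → ¬ CW (point a) (point b)
  point-¬window {a} {b} k<b∸a b<m+a =
    ¬window-by (m+n≤o⇒m≤o∸n (suc k) k<b∸a)
               (m<n+o⇒m∸n<o b a (subst (b <_) (+-comm m a) b<m+a)) (begin
      toℕ (point a) + (b ∸ a)   ≈⟨ ≡ₘ-+ʳ (b ∸ a) (point≡ₘ a) ⟩
      a + (b ∸ a)               ≡⟨ m+[n∸m]≡n (≤-trans (m≤n+m a (suc k)) k<b∸a) ⟩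
      b                         ≈⟨ point≡ₘ b ⟨
      toℕ (point b)             ∎)
    where open ≡ₘ-Reasoning

  point-+m : ∀ a → point (m + a) ≡ point a
  point-+m a = toℕ-injective (≡ₘ⇒≡ (toℕ<n (point (m + a))) (toℕ<n (point a)) (begin
    toℕ (point (m + a))   ≈⟨ point≡ₘ (m + a) ⟩
    m + a                 ≡⟨ +-comm m a ⟩
    a + m                 ≈⟨ +m≡ₘ a ⟩
    a                     ≈⟨ point≡ₘ a ⟨
    toℕ (point a)         ∎))
    where open ≡ₘ-Reasoning

  q : ℕ
  q = 2 + k

  vertex : ℕ → CrownCritical n k
  vertex s = (point ⌊ s /2⌋ , point ⌊ s + k /2⌋) , window⇒incomparable (point-window
    (⌊n/2⌋-mono (m≤m+n s k))
    (≤-trans (⌊n/2⌋-mono (subst (s + k ≤_) (+-comm s (k + k)) (+-monoʳ-≤ s (m≤n+m k k))))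
             (≤-reflexive (⌊t+t+n/2⌋≡t+⌊n/2⌋ k s))))

  vertex-adjacent : ∀ {s s′} → s + q ≤ s′ → s′ + q ≤ s + (m + m) → CrownCPAdj n k (vertex s) (vertex s′)
  vertex-adjacent {s} {s′} near far =
    ¬window⇒< (point-¬window k+i<j′ j′<m+i) ,
    ¬window⇒< (subst (λ b → ¬ CW (point i′) b) (point-+m j) (point-¬window k+i′<m+j (+-monoʳ-< m j<i′)))
    where
      i j i′ j′ : ℕ
      i  = ⌊ s /2⌋
      j  = ⌊ s + k /2⌋
      i′ = ⌊ s′ /2⌋
      j′ = ⌊ s′ + k /2⌋
      open ≤-Reasoning

      rearrange₁ : ∀ k s → suc k + suc k + s ≡ s + (2 + k) + k
      rearrange₁ = solve-∀
      rearrange₂ : ∀ k s → 1 + 1 + (s + k) ≡ s + (2 + k)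
      rearrange₂ = solve-∀
      rearrange₃ : ∀ s m k → s + (m + m) + k ≡ m + m + (s + k)
      rearrange₃ = solve-∀

      k+i<j′ : suc k + i ≤ j′
      k+i<j′ = ⌊/2⌋-shift (suc k) (begin
        suc k + suc k + s    ≡⟨ rearrange₁ k s ⟩
        s + q + k            ≤⟨ +-monoˡ-≤ k near ⟩
        s′ + k               ∎)

      j′<m+i : j′ < m + i
      j′<m+i = begin-strict
        j′                   <⟨ ⌊/2⌋-shift 1 (begin
                                  1 + 1 + (s′ + k)   ≡⟨ rearrange₂ k s′ ⟩
                                  s′ + q             ≤⟨ far ⟩
                                  s + (m + m)        ≡⟨ +-comm s (m + m) ⟩
                                  m + m + s          ∎) ⟩
        ⌊ m + m + s /2⌋      ≡⟨ ⌊t+t+n/2⌋≡t+⌊n/2⌋ m s ⟩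
        m + i                ∎

      k+i′<m+j : suc k + i′ ≤ m + j
      k+i′<m+j = begin
        suc k + i′               ≤⟨ ⌊/2⌋-shift (suc k) (begin
                                      suc k + suc k + s′   ≡⟨ rearrange₁ k s′ ⟩
                                      s′ + q + k           ≤⟨ +-monoˡ-≤ k far ⟩
                                      s + (m + m) + k      ≡⟨ rearrange₃ s m k ⟩
                                      m + m + (s + k)      ∎) ⟩
        ⌊ m + m + (s + k) /2⌋    ≡⟨ ⌊t+t+n/2⌋≡t+⌊n/2⌋ m (s + k) ⟩
        m + j                    ∎

      j<i′ : j < i′
      j<i′ = ⌊/2⌋-shift 1 (begin
        1 + 1 + (s + k)      ≡⟨ rearrange₂ k s ⟩
        s + q                ≤⟨ near ⟩
        s′                   ∎)


  D : ℕ
  D = (m + m + suc k) / q     -- ⌈ 2m / q ⌉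

  m+m≤D*q : m + m ≤ D * q
  m+m≤D*q = +-cancelʳ-≤ (suc k) (m + m) (D * q) (begin
    m + m + suc k                        ≡⟨ m≡m%n+[m/n]*n (m + m + suc k) q ⟩
    (m + m + suc k) % q + D * q          ≤⟨ +-monoˡ-≤ (D * q) (<⇒≤pred (m%n<n (m + m + suc k) q)) ⟩
    suc k + D * q                        ≡⟨ +-comm (suc k) (D * q) ⟩
    D * q + suc k                        ∎)
    where open ≤-Reasoning

  m+m≤c*q⇒D≤c : ∀ {c} → m + m ≤ c * q → D ≤ c
  m+m≤c*q⇒D≤c {c} m+m≤c*q = <⇒≤pred (m<n*o⇒m/o<n (begin-strict
    m + m + suc k      <⟨ +-monoʳ-< (m + m) ≤-refl ⟩
    m + m + q          ≤⟨ +-monoˡ-≤ q m+m≤c*q ⟩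
    c * q + q          ≡⟨ +-comm (c * q) q ⟩
    suc c * q          ∎))
    where open ≤-Reasoning

  colouring⇒D≤c : ∀ {c} → ProperColoring (CrownCPAdj n k) c → D ≤ c
  colouring⇒D≤c (colour , proper) = m+m≤c*q⇒D≤c (circularColouring⇒p≤c*Q
    (+-mono-≤ (s≤s k<m′) (s≤s k<m′))
    (λ s → colour (vertex (toℕ s)))
    (λ s s′ near far → proper (vertex (toℕ s)) (vertex (toℕ s′)) (vertex-adjacent near far)))

  opaque
    height : ℕ → ℕ → ℕ
    height h u with u ≤? k | u <? h
    ... | no  _ | _     = 0
    ... | yes _ | yes _ = suc u
    ... | yes _ | no  _ = suc (h + k ∸ u)

    height-out : ∀ {h u} → k < u → height h u ≡ 0
    height-out {h} {u} k<u with u ≤? k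
    ... | yes u≤k = contradiction u≤k (<⇒≱ k<u)
    ... | no  _   = refl

    height-low : ∀ {h u} → u ≤ k → u < h → height h u ≡ suc u
    height-low {h} {u} u≤k u<h with u ≤? k | u <? h
    ... | no  u≰k | _       = contradiction u≤k u≰k
    ... | yes _   | no  u≮h = contradiction u<h u≮h
    ... | yes _   | yes _   = refl

    height-high : ∀ {h u} → u ≤ k → h ≤ u → height h u ≡ suc (h + k ∸ u)
    height-high {h} {u} u≤k h≤u with u ≤? k | u <? h
    ... | no  u≰k | _       = contradiction u≤k u≰k
    ... | yes _   | yes u<h = contradiction h≤u (<⇒≱ u<h)
    ... | yes _   | no  _   = refl

  height-pos : ∀ {h u} → u ≤ k → 0 < height h u
  height-pos {h} {u} u≤k with h ≤? u
  ... | yes h≤u = subst (0 <_) (sym (height-high u≤k h≤u)) z<s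
  ... | no  h≰u = subst (0 <_) (sym (height-low u≤k (≰⇒> h≰u))) z<s

  Reversible : ℕ → ℕ → ℕ → Set
  Reversible h u t = (u < h × k ≤ u + t) ⊎ (h ≤ u × u + t ≤ k + h)

  -- The excluded v are those whose window, in rotated coordinates, contains u + t.
  height-dominates : ∀ {h u t v} → u ≤ k → t ≤ k → Reversible h u t →
                     ¬ (v ≤ u + t × u + t ≤ v + k) → height h v < height h u
  height-dominates {h} {u} {t} {v} u≤k t≤k rev ¬covers with v ≤? k
  ... | no  v≰k = subst (_< height h u) (sym (height-out {h} (≰⇒> v≰k))) (height-pos u≤k)
  ... | yes v≤k = dominates rev
    where
      open ≤-Reasoning
      dominates : Reversible h u t → height h v < height h u
      dominates (inj₁ (u<h , k≤u+t)) with v <? u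
      ... | no  v≮u = contradiction (≤-trans v≤k k≤u+t , +-mono-≤ (≮⇒≥ v≮u) t≤k) ¬covers
      ... | yes v<u = begin-strict
        height h v    ≡⟨ height-low v≤k (<-trans v<u u<h) ⟩
        suc v         <⟨ s<s v<u ⟩
        suc u         ≡⟨ height-low u≤k u<h ⟨
        height h u    ∎
      dominates (inj₂ (h≤u , u+t≤k+h)) with h ≤? v | v ≤? u
      ... | no  h≰v | _ = begin-strict
        height h v        ≡⟨ height-low v≤k (≰⇒> h≰v) ⟩
        suc v             <⟨ s<s (≰⇒> h≰v) ⟩
        suc h             ≤⟨ s≤s (m≤m+n h (k ∸ u)) ⟩
        suc (h + (k ∸ u)) ≡⟨ cong suc (+-∸-assoc h u≤k) ⟨
        suc (h + k ∸ u)   ≡⟨ height-high u≤k h≤u ⟨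
        height h u        ∎
      ... | yes h≤v | yes v≤u = contradiction
        (≤-trans v≤u (m≤m+n u t) , ≤-trans u+t≤k+h (subst (k + h ≤_) (+-comm k v) (+-monoʳ-≤ k h≤v)))
        ¬covers
      ... | yes h≤v | no  v≰u = begin-strict
        height h v        ≡⟨ height-high v≤k h≤v ⟩
        suc (h + k ∸ v)   <⟨ s<s (∸-monoʳ-< (≰⇒> v≰u) (≤-trans v≤k (m≤n+m k h))) ⟩
        suc (h + k ∸ u)   ≡⟨ height-high u≤k h≤u ⟨
        height h u        ∎

  start split : ℕ → ℕ
  start zero    = 0
  start (suc r) = suc (start r + split r)
  split zero    = ⌊ k /2⌋
  split (suc r) = k ∸ split r

  split≤k : ∀ r → split r ≤ k
  split≤k zero    = ⌊n/2⌋≤n k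
  split≤k (suc r) = m∸n≤m k (split r)

  -- Extension r reverses (a_x, b_{x+t}) whenever some X ≡ x (mod m) lies in [lo t r, hi t r].
  lo hi : ℕ → ℕ → ℕ
  lo t r = start r + (split r ⊓ (k ∸ t))
  hi t r = start r + (k ⊓ (k + split r ∸ t))

  lo-suc : ∀ {t} r → t ≤ k → lo t (suc r) ≡ suc (hi t r)
  lo-suc {t} r t≤k = cong suc (begin
    start r + h + ((k ∸ h) ⊓ (k ∸ t))        ≡⟨ +-assoc (start r) h _ ⟩
    start r + (h + ((k ∸ h) ⊓ (k ∸ t)))      ≡⟨ cong (start r +_) (+-distribˡ-⊓ h (k ∸ h) (k ∸ t)) ⟩
    start r + ((h + (k ∸ h)) ⊓ (h + (k ∸ t))) ≡⟨ cong₂ (λ a b → start r + (a ⊓ b)) (m+[n∸m]≡n (split≤k r))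
                                                   (trans (+-comm h (k ∸ t)) (sym (+-∸-comm h t≤k))) ⟩
    start r + (k ⊓ (k + h ∸ t))              ∎)
    where
      open ≡-Reasoning
      h = split r

  lo-+2 : ∀ t r → lo t (2 + r) ≡ q + lo t r
  lo-+2 t r = begin
    lo t (2 + r)                                          ≡⟨⟩
    suc (suc (start r + h) + (k ∸ h)) + ((k ∸ (k ∸ h)) ⊓ (k ∸ t)) ≡⟨ cong₂ (λ a b → suc (suc a) + (b ⊓ (k ∸ t)))
                                                                      (trans (+-assoc (start r) h (k ∸ h))
                                                                             (cong (start r +_) (m+[n∸m]≡n (split≤k r))))
                                                                      (m∸[m∸n]≡n (split≤k r)) ⟩
    suc (suc (start r + k)) + (h ⊓ (k ∸ t))              ≡⟨ cong (λ a → suc (suc a) + (h ⊓ (k ∸ t))) (+-comm (start r) k) ⟩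
    q + start r + (h ⊓ (k ∸ t))                          ≡⟨ +-assoc q (start r) _ ⟩
    q + lo t r                                           ∎
    where
      open ≡-Reasoning
      h = split r

  lo-growth : ∀ {t} r → r * q + (lo t 0 + lo t 0) ≤ suc (lo t r + lo t r)
  lo-growth {t} zero = n≤1+n _
  lo-growth {t} (suc zero) = begin
    1 * q + (L₀ + L₀)                  ≡⟨ rearrange k L₀ ⟩
    suc (suc k) + (L₀ + L₀)            ≤⟨ +-monoˡ-≤ (L₀ + L₀) (s≤s (s≤s (n≤1+⌊n/2⌋+⌊n/2⌋ k))) ⟩
    suc (suc (suc (H + H))) + (L₀ + L₀) ≡⟨ rearrange′ H L₀ ⟩
    suc (suc H + L₀ + (suc H + L₀))    ≤⟨ s≤s (+-mono-≤ L₁≥ L₁≥) ⟩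
    suc (lo t 1 + lo t 1)              ∎
    where
      open ≤-Reasoning
      H  = ⌊ k /2⌋
      L₀ = lo t 0
      H+H≤k : H + H ≤ k
      H+H≤k = ≤-trans (+-monoʳ-≤ H (⌊n/2⌋≤⌈n/2⌉ k)) (≤-reflexive (⌊n/2⌋+⌈n/2⌉≡n k))
      L₁≥ : suc H + L₀ ≤ lo t 1
      L₁≥ = s≤s (+-monoʳ-≤ H (⊓-monoˡ-≤ (k ∸ t) (m+n≤o⇒m≤o∸n H H+H≤k)))
      rearrange : ∀ k L → 1 * (2 + k) + (L + L) ≡ suc (suc k) + (L + L)
      rearrange = solve-∀
      rearrange′ : ∀ H L → suc (suc (suc (H + H))) + (L + L) ≡ suc (suc H + L + (suc H + L))
      rearrange′ = solve-∀
  lo-growth {t} (suc (suc r)) = begin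
    (2 + r) * q + (L₀ + L₀)            ≡⟨ rearrange r q (L₀ + L₀) ⟩
    q + q + (r * q + (L₀ + L₀))        ≤⟨ +-monoʳ-≤ (q + q) (lo-growth {t} r) ⟩
    q + q + suc (lo t r + lo t r)      ≡⟨ rearrange′ q (lo t r) ⟩
    suc ((q + lo t r) + (q + lo t r))  ≡⟨ cong (λ l → suc (l + l)) (lo-+2 t r) ⟨
    suc (lo t (2 + r) + lo t (2 + r))  ∎
    where
      open ≤-Reasoning
      L₀ = lo t 0
      rearrange : ∀ r q x → (2 + r) * q + x ≡ q + q + (r * q + x)
      rearrange = solve-∀
      rearrange′ : ∀ q l → q + q + suc (l + l) ≡ suc ((q + l) + (q + l))
      rearrange′ = solve-∀

  lo-D : ∀ t → lo t 0 + m ≤ lo t D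
  lo-D t = +-half (begin
    (lo t 0 + m) + (lo t 0 + m)        ≡⟨ rearrange (lo t 0) m ⟩
    (m + m) + (lo t 0 + lo t 0)        ≤⟨ +-monoˡ-≤ _ m+m≤D*q ⟩
    D * q + (lo t 0 + lo t 0)          ≤⟨ lo-growth {t} D ⟩
    suc (lo t D + lo t D)              ∎)
    where
      open ≤-Reasoning
      rearrange : ∀ l m → (l + m) + (l + m) ≡ (m + m) + (l + l)
      rearrange = solve-∀

  reversible-between : ∀ {h u t} → t ≤ k → h ⊓ (k ∸ t) ≤ u → u ≤ k + h ∸ t → Reversible h u t
  reversible-between {h} {u} {t} t≤k lower upper with u <? h
  ... | no  u≮h = inj₂ (≮⇒≥ u≮h , m≤o∸n⇒m+n≤o u (≤-trans t≤k (m≤m+n k h)) upper)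
  ... | yes u<h with ⊓-sel h (k ∸ t)
  ...   | inj₁ ⊓≡h = contradiction (subst (_≤ u) ⊓≡h lower) (<⇒≱ u<h)
  ...   | inj₂ ⊓≡k∸t = inj₁ (u<h , subst (_≤ u + t) (m∸n+n≡m t≤k) (+-monoˡ-≤ t (subst (_≤ u) ⊓≡k∸t lower)))

  phase-of : ∀ {t X} → t ≤ k → lo t 0 ≤ X → X < lo t D →
             ∃[ r ] r < D × start r ≤ X × X ∸ start r ≤ k × Reversible (split r) (X ∸ start r) t
  phase-of {t} {X} t≤k lo₀≤X X<lo-D with bracket (lo t) D lo₀≤X X<lo-D
  ... | r , r<D , lo≤X , X<lo′ =
    r , r<D , start≤X , ≤-trans upper (m⊓n≤m k _) ,
    reversible-between t≤k lower (≤-trans upper (m⊓n≤n k _))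
    where
      start≤X : start r ≤ X
      start≤X = ≤-trans (m≤m+n (start r) _) lo≤X
      lower : split r ⊓ (k ∸ t) ≤ X ∸ start r
      lower = m+n≤o⇒m≤o∸n _ (subst (_≤ X) (+-comm (start r) _) lo≤X)
      upper : X ∸ start r ≤ k ⊓ (k + split r ∸ t)
      upper = m≤n+o⇒m∸n≤o X (start r) (s≤s⁻¹ (subst (X <_) (lo-suc r t≤k) X<lo′))

  cover : ∀ {t} → t ≤ k → ∀ x →
          ∃[ ρ ] offset (start (toℕ ρ)) x ≤ k × Reversible (split (toℕ ρ)) (offset (start (toℕ ρ)) x) t
  cover {t} t≤k x = reindex (phase-of t≤k (m≤m+n L₀ (offset L₀ x))
                                     (<-≤-trans (+-monoʳ-< L₀ (offset<m L₀ x)) (lo-D t)))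
    where
      L₀ = lo t 0
      X  = L₀ + offset L₀ x
      reindex : ∃[ r ] r < D × start r ≤ X × X ∸ start r ≤ k × Reversible (split r) (X ∸ start r) t →
                ∃[ ρ ] offset (start (toℕ ρ)) x ≤ k × Reversible (split (toℕ ρ)) (offset (start (toℕ ρ)) x) t
      reindex (r , r<D , start≤X , u≤k , rev) =
        fromℕ< r<D ,
        subst (λ r → offset (start r) x ≤ k × Reversible (split r) (offset (start r) x) t)
              (sym (toℕ-fromℕ< r<D))
              (subst (λ u → u ≤ k × Reversible (split r) u t) (sym offset≡) (u≤k , rev))
        where
          offset≡ : offset (start r) x ≡ X ∸ start r
          offset≡ = offset-unique (≤-<-trans u≤k k<m)
                      (subst (_≡ₘ toℕ x) (sym (m+[n∸m]≡n start≤X)) (+offset≡ₘ L₀ x))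

  offsets⇒window : ∀ {c x y j t} → toℕ x + t ≡ₘ toℕ j →
                  offset c y ≤ offset c x + t → offset c x + t ≤ offset c y + k → CW y j
  offsets⇒window {c} {x} {y} {j} {t} x+t≡j uy≤ux+t ux+t≤uy+k =
    window-by (m≤n+o⇒m∸n≤o (ux + t) uy ux+t≤uy+k) (begin
      toℕ y + e               ≈⟨ ≡ₘ-+ʳ e (+offset≡ₘ c y) ⟨
      c + uy + e              ≡⟨ +-assoc c uy e ⟩
      c + (uy + e)            ≡⟨ cong (c +_) (m+[n∸m]≡n uy≤ux+t) ⟩
      c + (ux + t)            ≡⟨ +-assoc c ux t ⟨
      c + ux + t              ≈⟨ ≡ₘ-+ʳ t (+offset≡ₘ c x) ⟩
      toℕ x + t               ≈⟨ x+t≡j ⟩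
      toℕ j                   ∎)
    where
      open ≡ₘ-Reasoning
      ux = offset c x
      uy = offset c y
      e  = ux + t ∸ uy

  module Extension (c h : ℕ) where

    levelᵃ : Fin m → ℕ
    levelᵃ x = height h (offset c x)

    levelBelow : Fin m → Fin m → ℕ
    levelBelow j y with window? y j
    ... | yes _ = 0
    ... | no  _ = levelᵃ y

    levelᵇ : Fin m → ℕ
    levelᵇ j = suc (max (levelBelow j))

    levelᵃ<levelᵇ : ∀ {i j} → ¬ CW i j → levelᵃ i < levelᵇ j
    levelᵃ<levelᵇ {i} {j} ¬ij with window? i j | ≤-max (levelBelow j) i
    ... | yes ij | _    = contradiction ij ¬ij
    ... | no  _  | i≤max = s≤s i≤max

    opaque
      slot : CrownElem n k → ℕ
      slot (inj₁ x) = suc (2 * levelᵃ x)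
      slot (inj₂ j) = 2 * levelᵇ j

      key : CrownElem n k → ℕ
      key e = slot e * m + toℕ (reduce e)

      key-injective : Injective _≡_ _≡_ key
      key-injective {e} {e′} key≡ with *+-injective (toℕ<n (reduce e)) (toℕ<n (reduce e′)) key≡
      ... | slot≡ , index≡ = same-side e e′ slot≡ (toℕ-injective index≡)
        where
          same-side : ∀ e e′ → slot e ≡ slot e′ → reduce e ≡ reduce e′ → e ≡ e′
          same-side (inj₁ _) (inj₁ _) _ refl = refl
          same-side (inj₂ _) (inj₂ _) _ refl = refl
          same-side (inj₁ x) (inj₂ j) slot≡ _ = contradiction (sym slot≡) (even≢odd (levelᵇ j) (levelᵃ x))
          same-side (inj₂ j) (inj₁ x) slot≡ _ = contradiction slot≡ (even≢odd (levelᵇ j) (levelᵃ x))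

      key-mono : ∀ {e e′} → CrownLe n k e e′ → key e ≤ key e′
      key-mono le-refl              = ≤-refl
      key-mono (le-ab {i} {j} ¬ij) = <⇒≤ (*+-mono-< (toℕ j) (odd<even (levelᵃ<levelᵇ ¬ij)) (toℕ<n i))

      key-reverses : ∀ {x j} → levelᵇ j ≤ levelᵃ x → key (inj₂ j) ≤ key (inj₁ x)
      key-reverses {x} {j} b≤a = <⇒≤ (*+-mono-< (toℕ x) (even<odd b≤a) (toℕ<n j))

    L : LinearExtension (CrownLe n k)
    L = extensionByKey key key-injective key-mono

    levelᵇ≤levelᵃ : ∀ {x j t} → t ≤ k → toℕ x + t ≡ₘ toℕ j → offset c x ≤ k →
                    Reversible h (offset c x) t → levelᵇ j ≤ levelᵃ x
    levelᵇ≤levelᵃ {x} {j} {t} t≤k x+t≡j u≤k rev = max-< (levelBelow j) (height-pos u≤k) below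
      where
        below : ∀ y → levelBelow j y < levelᵃ x
        below y with window? y j
        ... | yes _   = height-pos u≤k
        ... | no  ¬yj = height-dominates u≤k t≤k rev λ (lo , hi) → ¬yj (offsets⇒window x+t≡j lo hi)

    reverses : ∀ {x j t} → t ≤ k → toℕ x + t ≡ₘ toℕ j → offset c x ≤ k →
               Reversible h (offset c x) t → _≤L_ L (inj₂ j) (inj₁ x)
    reverses t≤k x+t≡j u≤k rev = key-reverses (levelᵇ≤levelᵃ t≤k x+t≡j u≤k rev)

  separate-a : ∀ {i l} → l ≢ i → ∃[ j ] CW i j × ¬ CW l j
  separate-a {i} {l} l≢i with escape (s≤s k<m′) (offset-pos l≢i) (offset<m (toℕ l) i)
  ... | s , s≤k , k<d+s , d+s<m =
    point (toℕ i + s) , window-by s≤k (≡ₘ-sym (point≡ₘ (toℕ i + s))) , ¬window-by k<d+s d+s<m (begin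
      toℕ l + (d + s)       ≡⟨ +-assoc (toℕ l) d s ⟨
      toℕ l + d + s         ≈⟨ ≡ₘ-+ʳ s (+offset≡ₘ (toℕ l) i) ⟩
      toℕ i + s             ≈⟨ point≡ₘ (toℕ i + s) ⟨
      toℕ (point (toℕ i + s)) ∎)
    where
      open ≡ₘ-Reasoning
      d = offset (toℕ l) i

  separate-b : ∀ {i l} → l ≢ i → ∃[ x ] CW x l × ¬ CW x i
  separate-b {i} {l} l≢i with escape (s≤s k<m′) (offset-pos l≢i) (offset<m (toℕ l) i)
  ... | s , s≤k , k<d+s , d+s<m = x , window-by s≤k x+s≡l , ¬window-by k<d+s d+s<m x+d+s≡i
    where
      open ≡ₘ-Reasoning
      d = offset (toℕ l) i
      x = point (toℕ l + (m ∸ s))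
      m∸s+s≡m : m ∸ s + s ≡ m
      m∸s+s≡m = m∸n+n≡m (≤-trans s≤k (<⇒≤ k<m))
      regroup : ∀ l a d s → l + a + (d + s) ≡ l + d + (a + s)
      regroup = solve-∀
      x+s≡l : toℕ x + s ≡ₘ toℕ l
      x+s≡l = begin
        toℕ x + s                ≈⟨ ≡ₘ-+ʳ s (point≡ₘ (toℕ l + (m ∸ s))) ⟩
        toℕ l + (m ∸ s) + s      ≡⟨ +-assoc (toℕ l) (m ∸ s) s ⟩
        toℕ l + (m ∸ s + s)      ≡⟨ cong (toℕ l +_) m∸s+s≡m ⟩
        toℕ l + m                ≈⟨ +m≡ₘ (toℕ l) ⟩
        toℕ l                    ∎
      x+d+s≡i : toℕ x + (d + s) ≡ₘ toℕ i
      x+d+s≡i = begin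
        toℕ x + (d + s)              ≈⟨ ≡ₘ-+ʳ (d + s) (point≡ₘ (toℕ l + (m ∸ s))) ⟩
        toℕ l + (m ∸ s) + (d + s)    ≡⟨ regroup (toℕ l) (m ∸ s) d s ⟩
        toℕ l + d + (m ∸ s + s)      ≡⟨ cong (toℕ l + d +_) m∸s+s≡m ⟩
        toℕ l + d + m                ≈⟨ +m≡ₘ (toℕ l + d) ⟩
        toℕ l + d                    ≈⟨ +offset≡ₘ (toℕ l) i ⟩
        toℕ i                        ∎

  separate-crossing : ∀ {x j} → CW x j → ∃[ x′ ] ∃[ j′ ] CW x′ j′ × ¬ CW x′ j × ¬ CW x j′
  separate-crossing {x} {j} xj =
    x′ , j′ , window-by (m∸n≤m k t) x′+k∸t≡j′ ,
    ¬window-by k<m′ ≤-refl x′+m′≡j , ¬window-by ≤-refl (s≤s k<m′) x+k+1≡j′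
    where
      open ≡ₘ-Reasoning
      t  = offset (toℕ x) j
      b  = toℕ j + 1
      x′ = point b
      j′ = point (b + (k ∸ t))
      x′+k∸t≡j′ : toℕ x′ + (k ∸ t) ≡ₘ toℕ j′
      x′+k∸t≡j′ = ≡ₘ-trans (≡ₘ-+ʳ (k ∸ t) (point≡ₘ b)) (≡ₘ-sym (point≡ₘ (b + (k ∸ t))))
      x′+m′≡j : toℕ x′ + m′ ≡ₘ toℕ j
      x′+m′≡j = begin
        toℕ x′ + m′          ≈⟨ ≡ₘ-+ʳ m′ (point≡ₘ b) ⟩
        toℕ j + 1 + m′       ≡⟨ +-assoc (toℕ j) 1 m′ ⟩
        toℕ j + m            ≈⟨ +m≡ₘ (toℕ j) ⟩
        toℕ j                ∎
      x+k+1≡j′ : toℕ x + suc k ≡ₘ toℕ j′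
      x+k+1≡j′ = begin
        toℕ x + suc k                ≡⟨ cong (λ a → toℕ x + suc a) (m+[n∸m]≡n (window⇒offset≤k xj)) ⟨
        toℕ x + suc (t + (k ∸ t))    ≡⟨ regroup (toℕ x) t (k ∸ t) ⟩
        toℕ x + t + 1 + (k ∸ t)      ≈⟨ ≡ₘ-+ʳ (k ∸ t) (≡ₘ-+ʳ 1 (+offset≡ₘ (toℕ x) j)) ⟩
        b + (k ∸ t)                  ≈⟨ point≡ₘ (b + (k ∸ t)) ⟨
        toℕ j′                       ∎
        where
          regroup : ∀ x t a → x + suc (t + a) ≡ x + t + 1 + a
          regroup = solve-∀

  extension : Fin D → LinearExtension (CrownLe n k)
  extension ρ = Extension.L (start (toℕ ρ)) (split (toℕ ρ))

  critical-reversed : ∀ {i j} → CW i j → ∃[ ρ ] _≤L_ (extension ρ) (inj₂ j) (inj₁ i)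
  critical-reversed {i} {j} ij =
    let ρ , u≤k , rev = cover (window⇒offset≤k ij) i
    in ρ , Extension.reverses (start (toℕ ρ)) (split (toℕ ρ))
                              (window⇒offset≤k ij) (+offset≡ₘ (toℕ i) j) u≤k rev

  Blocked : CrownElem n k → CrownElem n k → Set
  Blocked x y = ∃[ i ] ∃[ j ] CW i j × CrownLe n k (inj₁ i) x × CrownLe n k y (inj₂ j)

  Trichotomy : CrownElem n k → CrownElem n k → Set
  Trichotomy x y = CrownLe n k x y ⊎ _<P_ (CrownLe n k) y x ⊎ Blocked x y

  ≤⊎>⊎blocked : ∀ x y → Trichotomy x y
  ≤⊎>⊎blocked (inj₁ i) (inj₁ l) = aa (i ≟ᶠ l)
    where
      aa : Dec (i ≡ l) → Trichotomy (inj₁ i) (inj₁ l)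
      aa (yes refl) = inj₁ le-refl
      aa (no  i≢l)  = let j , ij , ¬lj = separate-a (i≢l ∘ sym)
                      in inj₂ (inj₂ (i , j , ij , le-refl , le-ab ¬lj))
  ≤⊎>⊎blocked (inj₂ i) (inj₂ l) = bb (i ≟ᶠ l)
    where
      bb : Dec (i ≡ l) → Trichotomy (inj₂ i) (inj₂ l)
      bb (yes refl) = inj₁ le-refl
      bb (no  i≢l)  = let x , xl , ¬xi = separate-b (i≢l ∘ sym)
                      in inj₂ (inj₂ (x , l , xl , le-ab ¬xi , le-refl))
  ≤⊎>⊎blocked (inj₁ i) (inj₂ j) = ab (window? i j)
    where
      ab : Dec (CW i j) → Trichotomy (inj₁ i) (inj₂ j)
      ab (no  ¬ij) = inj₁ (le-ab ¬ij)
      ab (yes ij)  = inj₂ (inj₂ (i , j , ij , le-refl , le-refl))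
  ≤⊎>⊎blocked (inj₂ j) (inj₁ i) = ba (window? i j)
    where
      ba : Dec (CW i j) → Trichotomy (inj₂ j) (inj₁ i)
      ba (no  ¬ij) = inj₂ (inj₁ (¬window⇒< ¬ij))
      ba (yes ij)  = let x′ , j′ , x′j′ , ¬x′j , ¬ij′ = separate-crossing ij
                     in inj₂ (inj₂ (x′ , j′ , x′j′ , le-ab ¬x′j , le-ab ¬ij′))

  unblocked : ∀ {x y} → (∀ ρ → _≤L_ (extension ρ) x y) → ¬ Blocked x y
  unblocked all (i , j , ij , i≤x , y≤j) =
    let ρ , j≤i = critical-reversed ij
        L = extension ρ
    in contradiction (≤L-antisym L (≤L-trans L (extends L i≤x) (≤L-trans L (all ρ) (extends L y≤j))) j≤i) λ ()

  0<D : 0 < D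
  0<D = n≢0⇒n>0 λ D≡0 → contradiction (subst (λ d → m + m ≤ d * q) D≡0 m+m≤D*q) λ ()

  realizer : Realizer (CrownLe n k) D
  realizer = extension , realizes
    where
      ρ₀ : Fin D
      ρ₀ = fromℕ< 0<D
      realizes : ∀ x y → (∀ ρ → _≤L_ (extension ρ) x y) → CrownLe n k x y
      realizes x y all = [ id , [ reversed , flip contradiction (unblocked all) ]′ ]′ (≤⊎>⊎blocked x y)
        where
          reversed : _<P_ (CrownLe n k) y x → CrownLe n k x y
          reversed (y≤x , y≢x) =
            contradiction (≤L-antisym (extension ρ₀) (extends (extension ρ₀) y≤x) (all ρ₀)) y≢x

  dimension≡chromatic : ∃[ d ] (IsChromaticNumber (CrownCPAdj n k) d × IsDimension (CrownLe n k) d)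
  dimension≡chromatic =
    D , (realizer⇒colouring realizer , λ c c<D colouring → <⇒≱ c<D (colouring⇒D≤c colouring))
      , (realizer , λ d d<D realizer′ → <⇒≱ d<D (colouring⇒D≤c (realizer⇒colouring realizer′)))

theorem1p1 : (n k : ℕ) → 3 ≤ n →
    ∃[ d ] (IsChromaticNumber (CrownCPAdj n k) d × IsDimension (CrownLe n k) d)
theorem1p1 (suc (suc (suc n′))) k (s≤s (s≤s (s≤s _))) = Crown.dimension≡chromatic n′ k
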